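{- Let $G=(V,E)$ be a connected graph with at least two vertices and let $U\subseteq V$. If $\mathrm{evc}_U(G)=\mathrm{mvc}_U(G)$, then for every vertex $v\in V\setminus U$, $\mathrm{mvc}_{U\cup\{v\}}(G)=\mathrm{mvc}_U(G)$.
   Context: All graphs are finite and simple. Eternal vertex cover game: guards are placed on vertices of $G$, at most one guard per vertex; the set of occupied vertices is a configuration. In each round an attacker chooses an edge $uv$; the defender responds by moving guards simultaneously, each guard either staying put or moving to an adjacent vertex, such that at least one guard moves across the attacked edge, and after the move at most one guard is on each vertex; the number of guards never changes. An eternal vertex cover class of $G$ is a family $\mathcal{C}$ of vertex covers of $G$, all of the same cardinality, such that for every configuration $S\in\mathcal{C}$ and every attacked edge, the attack can be defended by a legal move leading to a configuration in $\mathcal{C}$. For $U\subseteq V$, $\mathrm{mvc}_U(G)$ is the minimum cardinality of a vertex cover of $G$ containing all vertices of $U$, and $\mathrm{evc}_U(G)$ is the minimum integer $k$ such that $G$ has an eternal vertex cover class in which every configuration is a vertex cover of cardinality $k$ containing all vertices of $U$. -}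

module Defs where

open import Data.Nat using (ℕ; _≤_)
open import Data.Fin using (Fin)
open import Data.Fin.Subset using (Subset; _∈_; _∉_; _⊆_; ∣_∣; _∪_; ⁅_⁆)
open import Data.Product using (Σ; ∃; _×_; _,_)
open import Data.Sum using (_⊎_)
open import Data.Empty using (⊥)
open import Relation.Nullary using (¬_)
open import Relation.Binary.PropositionalEquality using (_≡_)

record Graph (n : ℕ) : Set₁ where
  field
    Adj    : Fin n → Fin n → Set
    sym    : ∀ {u v} → Adj u v → Adj v u
    irrefl : ∀ {u} → ¬ Adj u u
open Graph public

data Reach {n : ℕ} (G : Graph n) : Fin n → Fin n → Set where
  here : ∀ {u} → Reach G u u
  step : ∀ {u v w} → Adj G u v → Reach G v w → Reach G u w

Connected : ∀ {n} → Graph n → Set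
Connected G = ∀ u v → Reach G u v

IsVertexCover : ∀ {n} → Graph n → Subset n → Set
IsVertexCover G S = ∀ u v → Adj G u v → (u ∈ S) ⊎ (v ∈ S)

IsMin : (ℕ → Set) → ℕ → Set
IsMin P m = P m × (∀ j → P j → m ≤ j)

HasVC : ∀ {n} → Graph n → Subset n → ℕ → Set
HasVC G U k = Σ (Subset _) λ S → IsVertexCover G S × U ⊆ S × ∣ S ∣ ≡ k

IsMvc : ∀ {n} → Graph n → Subset n → ℕ → Set
IsMvc G U = IsMin (HasVC G U)

-- A legal move of guards from configuration S to configuration S' that
-- defends the attacked edge uv.
record DefendingMove {n} (G : Graph n) (S S' : Subset n) (u v : Fin n) : Set where
  field
    f       : Fin n → Fin n
    local   : ∀ x → x ∈ S → (f x ≡ x) ⊎ Adj G x (f x)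
    inj     : ∀ x y → x ∈ S → y ∈ S → f x ≡ f y → x ≡ y
    image→  : ∀ x → x ∈ S → f x ∈ S'
    image←  : ∀ y → y ∈ S' → Σ (Fin n) λ x → x ∈ S × f x ≡ y
    crosses : Σ (Fin n) λ x → x ∈ S × ((x ≡ u × f x ≡ v) ⊎ (x ≡ v × f x ≡ u))

record EVCClass {n} (G : Graph n) (U : Subset n) (k : ℕ) : Set₁ where
  field
    C        : Subset n → Set
    nonempty : Σ (Subset n) C
    cover    : ∀ S → C S → IsVertexCover G S
    size     : ∀ S → C S → ∣ S ∣ ≡ k
    contains : ∀ S → C S → U ⊆ S
    defend   : ∀ S → C S → ∀ u v → Adj G u v →
               Σ (Subset n) λ S' → C S' × DefendingMove G S S' u v

HasEVCClass : ∀ {n} → Graph n → Subset n → ℕ → Set₁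
HasEVCClass G U k = EVCClass G U k

IsEvc : ∀ {n} → Graph n → Subset n → ℕ → Set₁
IsEvc G U m = HasEVCClass G U m × (∀ j → HasEVCClass G U j → m ≤ j)

-- Attack an edge vw at a vertex v ∉ U (such an edge exists since G is connected
-- with at least two vertices).  The defending guard crosses vw, so v is occupied
-- either before or after the move; in both cases some configuration of an
-- eternal vertex cover class of size mvc_U(G) contains v.  That configuration
-- is a vertex cover of size mvc_U(G) containing U ∪ {v}, and adding v to U can
-- never decrease the minimum.
module Submission where

open import Defs
open import Data.Nat using (ℕ; _≤_; suc; s≤s; z≤n)
open import Data.Fin using (Fin; zero; suc)
open import Data.Fin.Subset using (Subset; _∉_; _∪_; ⁅_⁆; _∈_; _⊆_)
open import Data.Fin.Subset.Properties using (x∈p∪q⁻; p⊆p∪q; x∈⁅y⁆⇒x≡y)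
open import Data.Product using (Σ; ∃; _×_; _,_)
open import Data.Sum using (inj₁; inj₂)
open import Data.Empty using (⊥-elim)
open import Relation.Nullary using (¬_)
open import Relation.Binary.PropositionalEquality using (_≡_; refl; subst)

∃-other : ∀ {n} (v : Fin (suc (suc n))) → ∃ λ u → ¬ v ≡ u
∃-other zero    = suc zero , λ ()
∃-other (suc v) = zero , λ ()

Reach⇒∃-neighbour : ∀ {n} {G : Graph n} {u v} → Reach G u v → ¬ u ≡ v → ∃ (Adj G u)
Reach⇒∃-neighbour here         u≢u = ⊥-elim (u≢u refl)
Reach⇒∃-neighbour (step u~w _) _   = _ , u~w

connected⇒∃-neighbour : ∀ {n} (G : Graph n) → 2 ≤ n → Connected G → ∀ v → ∃ (Adj G v)
connected⇒∃-neighbour G (s≤s (s≤s z≤n)) connected v with ∃-other v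
... | u , v≢u = Reach⇒∃-neighbour (connected v u) v≢u

∪-⁅⁆-⊆ : ∀ {n} {U S : Subset n} {v} → U ⊆ S → v ∈ S → U ∪ ⁅ v ⁆ ⊆ S
∪-⁅⁆-⊆ {U = U} {S} {v} U⊆S v∈S {x} x∈U∪v with x∈p∪q⁻ U ⁅ v ⁆ x∈U∪v
... | inj₁ x∈U = U⊆S x∈U
... | inj₂ x∈v with x∈⁅y⁆⇒x≡y v x∈v
...   | refl = v∈S

HasVC-∪⁻ : ∀ {n} {G : Graph n} {U : Subset n} v {k} → HasVC G (U ∪ ⁅ v ⁆) k → HasVC G U k
HasVC-∪⁻ v (S , cover , U∪v⊆S , size) = S , cover , (λ x∈U → U∪v⊆S (p⊆p∪q ⁅ v ⁆ x∈U)) , size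

module _ {n} {G : Graph n} {U : Subset n} {k} (𝒞 : EVCClass G U k) where
  open EVCClass 𝒞

  edge⇒occupied : ∀ {v w} → Adj G v w → Σ (Subset n) λ S → C S × v ∈ S
  edge⇒occupied {v} {w} v~w with nonempty
  ... | S , S∈C with defend S S∈C v w v~w
  ...   | S′ , S′∈C , move with DefendingMove.crosses move
  ...     | x , x∈S , inj₁ (refl , _) = S , S∈C , x∈S
  ...     | x , x∈S , inj₂ (_ , fx≡v) =
    S′ , S′∈C , subst (_∈ S′) fx≡v (DefendingMove.image→ move x x∈S)

  occupied⇒HasVC : ∀ {S v} → C S → v ∈ S → HasVC G (U ∪ ⁅ v ⁆) k
  occupied⇒HasVC {S} S∈C v∈S = S , cover S S∈C , ∪-⁅⁆-⊆ (contains S S∈C) v∈S , size S S∈C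

mainTheorem18 : ∀ {n : ℕ} (G : Graph n) → 2 ≤ n → Connected G →
    (U : Subset n) (m : ℕ) → IsMvc G U m → IsEvc G U m →
    ∀ v → v ∉ U → IsMvc G (U ∪ ⁅ v ⁆) m
mainTheorem18 G 2≤n connected U m (_ , mvc-least) (𝒞 , _) v _ = hasVC , least
  where
    hasVC : HasVC G (U ∪ ⁅ v ⁆) m
    hasVC with connected⇒∃-neighbour G 2≤n connected v
    ... | w , v~w with edge⇒occupied 𝒞 v~w
    ...   | S , S∈C , v∈S = occupied⇒HasVC 𝒞 S∈C v∈S

    least : ∀ j → HasVC G (U ∪ ⁅ v ⁆) j → m ≤ j
    least j cover = mvc-least j (HasVC-∪⁻ {G = G} v cover)
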